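{- Let $p>4$ be a prime and $r,m$ positive integers. Then \[ \sum_{\substack{i_{1}+i_{2}+i_{3}+i_{4}=mp^{r}\\ i_{1},i_{2},i_{3},i_{4}\in \mathcal{P}_{p}}}\frac{1}{i_{1}i_{2}i_{3}i_{4}}=\frac{24}{mp^{r}}\sum_{\substack{1\leq u_{1}< u_{2}< u_{3}\leq mp^{r}\\ u_{1},\ u_{3},\ u_{2}-u_{1},\ u_{3}-u_{2}\in \mathcal{P}_{p}}}\frac{1}{u_{1}u_{2}u_{3}}. \]
   Context: $\mathcal{P}_{n}$ denotes the set of positive integers coprime to $n$; the left sum runs over ordered quadruples of positive integers, each coprime to $p$, summing to $mp^r$; the right sum runs over integer triples $1\le u_1<u_2<u_3\le mp^r$ with $u_1$, $u_3$, $u_2-u_1$, $u_3-u_2$ all coprime to $p$. -}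

module Defs where

open import Data.Nat as ℕ using (ℕ; zero; suc; _∸_; _<_; _≤_)
open import Data.Nat.Coprimality using (Coprime; coprime?)
open import Data.Integer using (+_)
open import Data.Rational using (ℚ; 0ℚ; _/_; _+_; _*_)
open import Relation.Nullary using (Dec; yes; no)

-- reciprocal of a natural number as a rational (1/0 := 0; never used at 0 below)
inv : ℕ → ℚ
inv zero    = 0ℚ
inv (suc k) = (+ 1) / suc k

sumTo : ℕ → (ℕ → ℚ) → ℚ
sumTo zero    f = 0ℚ
sumTo (suc n) f = sumTo n f + f (suc n)

when : {P : ℕ → Set} → ((x : ℕ) → Dec (P x)) → ℕ → ℚ → ℚ
when P? x q with P? x
... | yes _ = q
... | no  _ = 0ℚ

ifLt : ℕ → ℕ → ℚ → ℚ
ifLt x y q with x ℕ.<? y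
... | yes _ = q
... | no  _ = 0ℚ

-- i ∈ 𝒫_p  (positive integer coprime to p); positivity is guaranteed by the ranges
inP : ℕ → ℕ → ℚ → ℚ
inP p i q = when (λ x → coprime? x p) i q

-- We range i1,i2,i3 over 1..N and set
-- i4 = N ∸ (i1+i2+i3), requiring i1+i2+i3 < N so that i4 ≥ 1.
lhsSum : ℕ → ℕ → ℚ
lhsSum p N =
  sumTo N λ i₁ → sumTo N λ i₂ → sumTo N λ i₃ →
    ifLt (i₁ ℕ.+ i₂ ℕ.+ i₃) N
      (inP p i₁ (inP p i₂ (inP p i₃ (inP p (N ∸ (i₁ ℕ.+ i₂ ℕ.+ i₃))
        (inv i₁ * inv i₂ * inv i₃ * inv (N ∸ (i₁ ℕ.+ i₂ ℕ.+ i₃)))))))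

rhsSum : ℕ → ℕ → ℚ
rhsSum p N =
  sumTo N λ u₁ → sumTo N λ u₂ → sumTo N λ u₃ →
    ifLt u₁ u₂ (ifLt u₂ u₃
      (inP p u₁ (inP p u₃ (inP p (u₂ ∸ u₁) (inP p (u₃ ∸ u₂)
        (inv u₁ * inv u₂ * inv u₃))))))

module Submission where

-- Write N = m pʳ and let χ(x) ∈ {0, 1} indicate gcd(x, p) = 1.  The left-hand
-- side is Σ𝒫 (1/(abcd)), where Σ𝒫 sums over the compositions a + b + c + d = N with every
-- part coprime to p; this sum is invariant under permuting the parts.
--  1. Partial fractions, 1/(abcd) = (1/N)(1/(bcd) + 1/(acd) + 1/(abd) + 1/(abc)), together
--     with the symmetry give  LHS = (4/N) Σ𝒫 1/(abc).
--  2. Summing 1/(x (x+y) (x+y+z)) over the six orders of (a, b, c) gives 1/(abc); by symmetry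
--     Σ𝒫 1/(abc) = 6 Σ𝒫 1/(a (a+b) (a+b+c)).
--  3. The change of variables u₁ = a, u₂ = a + b, u₃ = a + b + c identifies the last sum with
--     the right-hand sum, because χ(d) = χ(N - u₃) = χ(u₃) as p ∣ N.

open import Defs
open import Data.Nat as ℕ using (ℕ; _<_; _^_)
open import Data.Nat.Primality using (Prime)
open import Data.Integer using (+_)
open import Data.Rational using (_/_; _*_)
open import Relation.Binary.PropositionalEquality using (_≡_)

open import Algebra.Bundles using (CommutativeMonoid)
open import Data.Nat using (zero; suc; _∸_; _≤_; z≤n; s≤s)
import Data.Nat.Properties as ℕP
import Algebra.Properties.CommutativeSemigroup ℕP.+-commutativeSemigroup as ℕ+
open import Data.Nat.Divisibility using (_∣_; _∣0; ∣-refl; ∣-trans; ∣m+n∣m⇒∣n; m∣m*n; ∣n⇒∣m*n)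
open import Data.Nat.Coprimality using (Coprime; coprime?)
import Data.Integer as ℤ
import Data.Integer.Properties as ℤP
open import Data.Rational using (ℚ; 0ℚ; 1ℚ; _+_; toℚᵘ)
import Data.Rational.Properties as ℚP
import Algebra.Properties.CommutativeSemigroup
  (CommutativeMonoid.commutativeSemigroup ℚP.+-0-commutativeMonoid) as ℚ+
import Data.Rational.Unnormalised as ℚᵘ
import Data.Rational.Unnormalised.Properties as ℚᵘP
open import Data.Rational.Solver using (module +-*-Solver)
open +-*-Solver using (solve; _:+_; _:*_; _:=_; con)
open import Data.Product using (_,_)
open import Data.Sum using (inj₁; inj₂)
open import Function using (_∘_)
open import Relation.Nullary using (¬_; Dec; yes; no; contradiction)
open import Relation.Binary.PropositionalEquality
  using (refl; sym; trans; cong; cong₂; subst; _≢_; module ≡-Reasoning)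

sum-cong : ∀ n {f g : ℕ → ℚ} → (∀ i → 1 ≤ i → i ≤ n → f i ≡ g i) → sumTo n f ≡ sumTo n g
sum-cong zero    eq = refl
sum-cong (suc n) eq =
  cong₂ _+_ (sum-cong n λ i 1≤i i≤n → eq i 1≤i (ℕP.m≤n⇒m≤1+n i≤n)) (eq (suc n) (s≤s z≤n) ℕP.≤-refl)

sum-ext : ∀ n {f g : ℕ → ℚ} → (∀ i → f i ≡ g i) → sumTo n f ≡ sumTo n g
sum-ext n eq = sum-cong n λ i _ _ → eq i

sum-zero : ∀ n {f : ℕ → ℚ} → (∀ i → 1 ≤ i → i ≤ n → f i ≡ 0ℚ) → sumTo n f ≡ 0ℚ
sum-zero zero    eq = refl
sum-zero (suc n) eq = trans
  (cong₂ _+_ (sum-zero n λ i 1≤i i≤n → eq i 1≤i (ℕP.m≤n⇒m≤1+n i≤n)) (eq (suc n) (s≤s z≤n) ℕP.≤-refl))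
  (ℚP.+-identityʳ 0ℚ)

sum-+ : ∀ n (f g : ℕ → ℚ) → sumTo n (λ i → f i + g i) ≡ sumTo n f + sumTo n g
sum-+ zero    f g = refl
sum-+ (suc n) f g = trans (cong (_+ (f (suc n) + g (suc n))) (sum-+ n f g))
                          (ℚ+.interchange (sumTo n f) (sumTo n g) (f (suc n)) (g (suc n)))

sum-*ˡ : ∀ n k (f : ℕ → ℚ) → sumTo n (λ i → k * f i) ≡ k * sumTo n f
sum-*ˡ zero    k f = sym (ℚP.*-zeroʳ k)
sum-*ˡ (suc n) k f = trans (cong (_+ (k * f (suc n))) (sum-*ˡ n k f))
                           (sym (ℚP.*-distribˡ-+ k (sumTo n f) (f (suc n))))

sum-*ˡ₂ : ∀ n x y (f : ℕ → ℚ) → sumTo n (λ i → x * (y * f i)) ≡ x * (y * sumTo n f)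
sum-*ˡ₂ n x y f = trans (sum-*ˡ n x (λ i → y * f i)) (cong (x *_) (sum-*ˡ n y f))

sum-factor₃ : ∀ n (x y : ℕ → ℚ) (x′ y′ : ℕ → ℕ → ℚ) (t : ℕ → ℕ → ℕ → ℚ) →
  sumTo n (λ i → sumTo n (λ j → sumTo n (λ k → x i * (y i * (x′ i j * (y′ i j * t i j k)))))) ≡
  sumTo n (λ i → x i * (y i * sumTo n (λ j → x′ i j * (y′ i j * sumTo n (t i j)))))
sum-factor₃ n x y x′ y′ t = sum-ext n λ i →
  trans (sum-ext n (λ j → sum-*ˡ₂ n (x i) (y i) (λ k → x′ i j * (y′ i j * t i j k))))
 (trans (sum-*ˡ₂ n (x i) (y i) (λ j → sumTo n (λ k → x′ i j * (y′ i j * t i j k))))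
        (cong (λ z → x i * (y i * z)) (sum-ext n λ j → sum-*ˡ₂ n (x′ i j) (y′ i j) (t i j))))

fubini : ∀ n m (f : ℕ → ℕ → ℚ) →
  sumTo n (λ i → sumTo m (f i)) ≡ sumTo m (λ j → sumTo n (λ i → f i j))
fubini zero    m f = sym (sum-zero m λ _ _ _ → refl)
fubini (suc n) m f = trans (cong (_+ sumTo m (f (suc n))) (fubini n m f)) (sym (sum-+ m _ _))

sum-unfoldˡ : ∀ n (f : ℕ → ℚ) → sumTo (suc n) f ≡ f 1 + sumTo n (λ i → f (suc i))
sum-unfoldˡ zero    f = trans (ℚP.+-identityˡ (f 1)) (sym (ℚP.+-identityʳ (f 1)))
sum-unfoldˡ (suc n) f = trans (cong (_+ f (suc (suc n))) (sum-unfoldˡ n f))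
                              (ℚP.+-assoc (f 1) _ (f (suc (suc n))))

sum-single : ∀ n t {f : ℕ → ℚ} → 1 ≤ t → t ≤ n → (∀ i → i ≢ t → f i ≡ 0ℚ) → sumTo n f ≡ f t
sum-single zero    t 1≤t t≤0 _ = contradiction (ℕP.≤-trans 1≤t t≤0) λ ()
sum-single (suc n) t {f} 1≤t t≤1+n off with ℕP.m≤n⇒m<n∨m≡n t≤1+n
... | inj₂ refl = trans (cong (_+ f t) (sum-zero n λ i _ i≤n → off i (ℕP.<⇒≢ (s≤s i≤n))))
                        (ℚP.+-identityˡ (f t))
... | inj₁ t<1+n = trans (cong₂ _+_ (sum-single n t 1≤t (ℕP.≤-pred t<1+n) off)
                                    (off (suc n) λ 1+n≡t → ℕP.<⇒≢ t<1+n (sym 1+n≡t)))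
                         (ℚP.+-identityʳ (f t))

-- Reindexing by a shift: if φ 0 = 0 and ψ vanishes beyond n, then
--   Σ_{v=1}^n φ(v - k) ψ(v) = Σ_{c=1}^n φ(c) ψ(k + c),
-- the terms v ≤ k on the left and k + c > n on the right being zero.
sum-shift : ∀ k n {φ ψ : ℕ → ℚ} → φ 0 ≡ 0ℚ → (∀ v → n < v → ψ v ≡ 0ℚ) →
  sumTo n (λ v → φ (v ∸ k) * ψ v) ≡ sumTo n (λ c → φ c * ψ (k ℕ.+ c))
sum-shift zero    n       φ0 ψ>n = refl
sum-shift (suc k) zero    φ0 ψ>n = refl
sum-shift (suc k) (suc n) {φ} {ψ} φ0 ψ>n = begin
  sumTo (suc n) (λ v → φ (v ∸ suc k) * ψ v)
    ≡⟨ sum-unfoldˡ n (λ v → φ (v ∸ suc k) * ψ v) ⟩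
  φ (0 ∸ k) * ψ 1 + sumTo n (λ i → φ (i ∸ k) * ψ (suc i))
    ≡⟨ trans (cong (_+ shifted) first-term-vanishes) (ℚP.+-identityˡ shifted) ⟩
  sumTo n (λ i → φ (i ∸ k) * ψ (suc i))
    ≡⟨ sum-shift k n {φ} {ψ ∘ suc} φ0 (λ v n<v → ψ>n (suc v) (s≤s n<v)) ⟩
  reindexed
    ≡⟨ sym (trans (cong (λ t → reindexed + t) last-term-vanishes) (ℚP.+-identityʳ reindexed)) ⟩
  sumTo (suc n) (λ c → φ c * ψ (suc k ℕ.+ c)) ∎
  where
  open ≡-Reasoning
  shifted reindexed : ℚ
  shifted   = sumTo n (λ i → φ (i ∸ k) * ψ (suc i))
  reindexed = sumTo n (λ c → φ c * ψ (suc k ℕ.+ c))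
  first-term-vanishes : φ (0 ∸ k) * ψ 1 ≡ 0ℚ
  first-term-vanishes = trans (cong (λ z → φ z * ψ 1) (ℕP.0∸n≡0 k))
                              (trans (cong (_* ψ 1) φ0) (ℚP.*-zeroˡ (ψ 1)))
  last-term-vanishes : φ (suc n) * ψ (suc k ℕ.+ suc n) ≡ 0ℚ
  last-term-vanishes = trans (cong (φ (suc n) *_) (ψ>n _ (s≤s (ℕP.m≤n+m (suc n) k))))
                             (ℚP.*-zeroʳ (φ (suc n)))

module _ {P : ℕ → Set} (P? : ∀ x → Dec (P x)) where

  when-yes : ∀ {x} q → P x → when P? x q ≡ q
  when-yes {x} q px with P? x
  ... | yes _   = refl
  ... | no ¬px = contradiction px ¬px

  when-no : ∀ {x} q → ¬ P x → when P? x q ≡ 0ℚ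
  when-no {x} q ¬px with P? x
  ... | yes px = contradiction px ¬px
  ... | no _   = refl

  when-cong : ∀ {x q r} → (P x → q ≡ r) → when P? x q ≡ when P? x r
  when-cong {x} eq with P? x
  ... | yes px = eq px
  ... | no _   = refl

  when-+ : ∀ x q r → when P? x (q + r) ≡ when P? x q + when P? x r
  when-+ x q r with P? x
  ... | yes _ = refl
  ... | no _  = refl

  when-*ˡ : ∀ x k q → when P? x (k * q) ≡ k * when P? x q
  when-*ˡ x k q with P? x
  ... | yes _ = refl
  ... | no _  = sym (ℚP.*-zeroʳ k)

  when-⇔ : ∀ x y q → (P x → P y) → (P y → P x) → when P? x q ≡ when P? y q
  when-⇔ x y q x⇒y y⇒x with P? x | P? y
  ... | yes _  | yes _  = refl
  ... | no _   | no _   = refl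
  ... | yes px | no ¬py = contradiction (x⇒y px) ¬py
  ... | no ¬px | yes py = contradiction (y⇒x py) ¬px

  when-indicator : ∀ x q → when P? x q ≡ when P? x 1ℚ * q
  when-indicator x q with P? x
  ... | yes _ = sym (ℚP.*-identityˡ q)
  ... | no _  = sym (ℚP.*-zeroˡ q)

ifLt-yes : ∀ {x y} q → x < y → ifLt x y q ≡ q
ifLt-yes {x} {y} q x<y with x ℕ.<? y
... | yes _   = refl
... | no x≮y = contradiction x<y x≮y

ifLt-no : ∀ {x y} q → ¬ x < y → ifLt x y q ≡ 0ℚ
ifLt-no {x} {y} q x≮y with x ℕ.<? y
... | yes x<y = contradiction x<y x≮y
... | no _    = refl

ifLt-redundant : ∀ x y q → (y ≤ x → q ≡ 0ℚ) → ifLt x y q ≡ q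
ifLt-redundant x y q q0 with x ℕ.<? y
... | yes _   = refl
... | no x≮y = sym (q0 (ℕP.≮⇒≥ x≮y))

-- Summing out the last part of a composition: among d = 1 … N only
-- d = N - s satisfies s + d = N, and it is in range exactly when s < N.
sum-last-part : ∀ N s (f : ℕ → ℚ) →
  sumTo N (λ d → when (ℕ._≟ N) (s ℕ.+ d) (f d)) ≡ ifLt s N (f (N ∸ s))
sum-last-part N s f = by-cases (s ℕ.<? N)
  where
  open ≡-Reasoning
  lhs : ℚ
  lhs = sumTo N (λ d → when (ℕ._≟ N) (s ℕ.+ d) (f d))

  by-cases : Dec (s < N) → lhs ≡ ifLt s N (f (N ∸ s))
  by-cases (yes s<N) = begin
    lhs                                        ≡⟨ sum-single N (N ∸ s) (ℕP.m<n⇒0<n∸m s<N) (ℕP.m∸n≤m N s) off ⟩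
    when (ℕ._≟ N) (s ℕ.+ (N ∸ s)) (f (N ∸ s))  ≡⟨ when-yes (ℕ._≟ N) (f (N ∸ s)) (ℕP.m+[n∸m]≡n (ℕP.<⇒≤ s<N)) ⟩
    f (N ∸ s)                                  ≡⟨ sym (ifLt-yes (f (N ∸ s)) s<N) ⟩
    ifLt s N (f (N ∸ s))                       ∎
    where
    off : ∀ d → d ≢ N ∸ s → when (ℕ._≟ N) (s ℕ.+ d) (f d) ≡ 0ℚ
    off d d≢N∸s = when-no (ℕ._≟ N) (f d) λ s+d≡N →
      d≢N∸s (trans (sym (ℕP.m+n∸m≡n s d)) (cong (_∸ s) s+d≡N))
  by-cases (no s≮N) = trans
    (sum-zero N λ d 1≤d _ → when-no (ℕ._≟ N) (f d) λ s+d≡N →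
       s≮N (subst (s <_) s+d≡N (ℕP.m<m+n s 1≤d)))
    (sym (ifLt-no (f (N ∸ s)) s≮N))

fromℕ : ℕ → ℚ
fromℕ n = (+ n) / 1

ℕ→ℚᵘ : ℕ → ℚᵘ.ℚᵘ
ℕ→ℚᵘ n = ℚᵘ.mkℚᵘ (+ n) 0

fromℕ-+ : ∀ m n → fromℕ (m ℕ.+ n) ≡ fromℕ m + fromℕ n
fromℕ-+ m n = ℚP.toℚᵘ-injective (begin
  toℚᵘ (fromℕ (m ℕ.+ n))                 ≈⟨ ℚP.toℚᵘ-fromℚᵘ (ℕ→ℚᵘ (m ℕ.+ n)) ⟩
  ℕ→ℚᵘ (m ℕ.+ n)                         ≈⟨ ℚᵘ.*≡* cross-multiplied ⟩
  ℕ→ℚᵘ m ℚᵘ.+ ℕ→ℚᵘ n                     ≈⟨ ℚᵘP.+-cong (ℚᵘP.≃-sym (ℚP.toℚᵘ-fromℚᵘ (ℕ→ℚᵘ m)))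
                                                       (ℚᵘP.≃-sym (ℚP.toℚᵘ-fromℚᵘ (ℕ→ℚᵘ n))) ⟩
  toℚᵘ (fromℕ m) ℚᵘ.+ toℚᵘ (fromℕ n)     ≈⟨ ℚᵘP.≃-sym (ℚP.toℚᵘ-homo-+ (fromℕ m) (fromℕ n)) ⟩
  toℚᵘ (fromℕ m + fromℕ n)               ∎)
  where
  open ℚᵘP.≃-Reasoning
  cross-multiplied : + (m ℕ.+ n) ℤ.* + 1 ≡ (+ m ℤ.* + 1 ℤ.+ + n ℤ.* + 1) ℤ.* + 1
  cross-multiplied = trans (ℤP.*-identityʳ _) (trans (ℤP.pos-+ m n) (sym (trans (ℤP.*-identityʳ _)
    (cong₂ ℤ._+_ (ℤP.*-identityʳ (+ m)) (ℤP.*-identityʳ (+ n))))))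

inv-*-fromℕ : ∀ n → 1 ≤ n → inv n * fromℕ n ≡ 1ℚ
inv-*-fromℕ (suc k) _ = ℚP.toℚᵘ-injective (begin
  toℚᵘ (inv (suc k) * fromℕ (suc k))                ≈⟨ ℚP.toℚᵘ-homo-* (inv (suc k)) (fromℕ (suc k)) ⟩
  toℚᵘ (inv (suc k)) ℚᵘ.* toℚᵘ (fromℕ (suc k))      ≈⟨ ℚᵘP.*-cong (ℚP.toℚᵘ-fromℚᵘ (ℚᵘ.mkℚᵘ (+ 1) k))
                                                                  (ℚP.toℚᵘ-fromℚᵘ (ℕ→ℚᵘ (suc k))) ⟩
  ℚᵘ.1/ ℕ→ℚᵘ (suc k) ℚᵘ.* ℕ→ℚᵘ (suc k)              ≈⟨ ℚᵘP.*-inverseˡ (ℕ→ℚᵘ (suc k)) ⟩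
  ℚᵘ.1ℚᵘ                                            ∎)
  where open ℚᵘP.≃-Reasoning

positive-+ : ∀ {m} n → 1 ≤ m → 1 ≤ m ℕ.+ n
positive-+ n 1≤m = ℕP.≤-trans 1≤m (ℕP.m≤m+n _ n)

cancel : ∀ n → 1 ≤ n → ∀ q → fromℕ n * (inv n * q) ≡ q
cancel n 1≤n q = begin
  fromℕ n * (inv n * q)   ≡⟨ sym (ℚP.*-assoc (fromℕ n) (inv n) q) ⟩
  (fromℕ n * inv n) * q   ≡⟨ cong (_* q) (trans (ℚP.*-comm (fromℕ n) (inv n)) (inv-*-fromℕ n 1≤n)) ⟩
  1ℚ * q                  ≡⟨ ℚP.*-identityˡ q ⟩
  q                       ∎
  where open ≡-Reasoning

divide : ∀ s → 1 ≤ s → ∀ {q r} → fromℕ s * q ≡ r → q ≡ inv s * r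
divide s 1≤s {q} {r} sq≡r = begin
  q                          ≡⟨ sym (ℚP.*-identityˡ q) ⟩
  1ℚ * q                     ≡⟨ cong (_* q) (sym (inv-*-fromℕ s 1≤s)) ⟩
  (inv s * fromℕ s) * q      ≡⟨ ℚP.*-assoc (inv s) (fromℕ s) q ⟩
  inv s * (fromℕ s * q)      ≡⟨ cong (inv s *_) sq≡r ⟩
  inv s * r                  ∎
  where open ≡-Reasoning

-- Partial fractions: for positive x₁ … xₖ with sum s,
--   1/(x₁⋯xₖ) = (1/s) · Σᵢ Π_{j≠i} 1/xⱼ,
-- since s · Π 1/xⱼ = Σᵢ xᵢ · Π 1/xⱼ.  The cases k = 2, 3, 4 are needed.
partial-fractions₂ : ∀ x y → 1 ≤ x → 1 ≤ y →
  inv x * inv y ≡ inv (x ℕ.+ y) * (inv x + inv y)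
partial-fractions₂ x y 1≤x 1≤y = divide (x ℕ.+ y) (positive-+ y 1≤x) (begin
  fromℕ (x ℕ.+ y) * (ix * iy)          ≡⟨ cong (_* (ix * iy)) (fromℕ-+ x y) ⟩
  (X + Y) * (ix * iy)                  ≡⟨ solve 4 (λ X Y ix iy → (X :+ Y) :* (ix :* iy)
                                                     := X :* (ix :* iy) :+ Y :* (iy :* ix)) refl X Y ix iy ⟩
  X * (ix * iy) + Y * (iy * ix)        ≡⟨ cong₂ _+_ (cancel x 1≤x iy) (cancel y 1≤y ix) ⟩
  iy + ix                              ≡⟨ ℚP.+-comm iy ix ⟩
  ix + iy                              ∎)
  where
  open ≡-Reasoning
  X Y ix iy : ℚ
  X = fromℕ x; Y = fromℕ y; ix = inv x; iy = inv y

partial-fractions₃ : ∀ a b c → 1 ≤ a → 1 ≤ b → 1 ≤ c →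
  inv a * inv b * inv c ≡ inv (a ℕ.+ b ℕ.+ c) * (inv b * inv c + inv a * inv c + inv a * inv b)
partial-fractions₃ a b c 1≤a 1≤b 1≤c = divide (a ℕ.+ b ℕ.+ c) (positive-+ c (positive-+ b 1≤a)) (begin
  fromℕ (a ℕ.+ b ℕ.+ c) * (ia * ib * ic)
    ≡⟨ cong (_* (ia * ib * ic)) (trans (fromℕ-+ (a ℕ.+ b) c) (cong (_+ C) (fromℕ-+ a b))) ⟩
  (A + B + C) * (ia * ib * ic)
    ≡⟨ solve 6 (λ A B C ia ib ic → (A :+ B :+ C) :* (ia :* ib :* ic)
                 := A :* (ia :* (ib :* ic)) :+ B :* (ib :* (ia :* ic)) :+ C :* (ic :* (ia :* ib)))
               refl A B C ia ib ic ⟩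
  A * (ia * (ib * ic)) + B * (ib * (ia * ic)) + C * (ic * (ia * ib))
    ≡⟨ cong₂ _+_ (cong₂ _+_ (cancel a 1≤a _) (cancel b 1≤b _)) (cancel c 1≤c _) ⟩
  ib * ic + ia * ic + ia * ib ∎)
  where
  open ≡-Reasoning
  A B C ia ib ic : ℚ
  A = fromℕ a; B = fromℕ b; C = fromℕ c; ia = inv a; ib = inv b; ic = inv c

partial-fractions₄ : ∀ a b c d → 1 ≤ a → 1 ≤ b → 1 ≤ c → 1 ≤ d →
  inv a * inv b * inv c * inv d ≡
  inv (a ℕ.+ b ℕ.+ c ℕ.+ d) * (inv b * inv c * inv d + inv a * inv c * inv d
                                + inv a * inv b * inv d + inv a * inv b * inv c)
partial-fractions₄ a b c d 1≤a 1≤b 1≤c 1≤d =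
  divide (a ℕ.+ b ℕ.+ c ℕ.+ d) (positive-+ d (positive-+ c (positive-+ b 1≤a))) (begin
  fromℕ (a ℕ.+ b ℕ.+ c ℕ.+ d) * (ia * ib * ic * id)
    ≡⟨ cong (_* (ia * ib * ic * id)) (trans (fromℕ-+ (a ℕ.+ b ℕ.+ c) d)
         (cong (_+ D) (trans (fromℕ-+ (a ℕ.+ b) c) (cong (_+ C) (fromℕ-+ a b))))) ⟩
  (A + B + C + D) * (ia * ib * ic * id)
    ≡⟨ solve 8 (λ A B C D ia ib ic id → (A :+ B :+ C :+ D) :* (ia :* ib :* ic :* id)
                 := A :* (ia :* (ib :* ic :* id)) :+ B :* (ib :* (ia :* ic :* id))
                    :+ C :* (ic :* (ia :* ib :* id)) :+ D :* (id :* (ia :* ib :* ic)))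
               refl A B C D ia ib ic id ⟩
  A * (ia * (ib * ic * id)) + B * (ib * (ia * ic * id)) + C * (ic * (ia * ib * id)) + D * (id * (ia * ib * ic))
    ≡⟨ cong₂ _+_ (cong₂ _+_ (cong₂ _+_ (cancel a 1≤a _) (cancel b 1≤b _)) (cancel c 1≤c _)) (cancel d 1≤d _) ⟩
  ib * ic * id + ia * ic * id + ia * ib * id + ia * ib * ic ∎)
  where
  open ≡-Reasoning
  A B C D ia ib ic id : ℚ
  A = fromℕ a; B = fromℕ b; C = fromℕ c; D = fromℕ d
  ia = inv a; ib = inv b; ic = inv c; id = inv d

prefix-inv : ℕ → ℕ → ℕ → ℚ
prefix-inv x y z = inv x * inv (x ℕ.+ y) * inv (x ℕ.+ y ℕ.+ z)

prefix-pair : ∀ x y → 1 ≤ x → 1 ≤ y → inv x * inv (x ℕ.+ y) + inv y * inv (y ℕ.+ x) ≡ inv x * inv y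
prefix-pair x y 1≤x 1≤y = begin
  inv x * inv (x ℕ.+ y) + inv y * inv (y ℕ.+ x) ≡⟨ cong (λ n → inv x * inv (x ℕ.+ y) + inv y * inv n) (ℕP.+-comm y x) ⟩
  inv x * u + inv y * u                          ≡⟨ solve 3 (λ ix iy u → ix :* u :+ iy :* u := u :* (ix :+ iy)) refl (inv x) (inv y) u ⟩
  u * (inv x + inv y)                            ≡⟨ sym (partial-fractions₂ x y 1≤x 1≤y) ⟩
  inv x * inv y                                  ∎
  where
  open ≡-Reasoning
  u : ℚ
  u = inv (x ℕ.+ y)

-- Summing over the six orders of a, b, c:  Σ_σ prefix-inv (σ(a,b,c)) = 1/(abc).
-- Group the orders by their last element and apply prefix-pair, then partial-fractions₃.
prefix-inv-orders : ∀ a b c → 1 ≤ a → 1 ≤ b → 1 ≤ c →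
  prefix-inv a b c + prefix-inv a c b + prefix-inv b a c
    + prefix-inv b c a + prefix-inv c a b + prefix-inv c b a ≡ inv a * inv b * inv c
prefix-inv-orders a b c 1≤a 1≤b 1≤c = begin
  prefix-inv a b c + prefix-inv a c b + prefix-inv b a c
    + prefix-inv b c a + prefix-inv c a b + prefix-inv c b a
    ≡⟨ cong₂ _+_ (cong₂ _+_ (cong₂ _+_ (cong₂ _+_ (cong₂ _+_
         (total a b c refl) (total a c b (ℕ+.xy∙z≈xz∙y a c b))) (total b a c (ℕ+.xy∙z≈yx∙z b a c)))
         (total b c a (ℕ+.xy∙z≈zx∙y b c a))) (total c a b (ℕ+.xy∙z≈yz∙x c a b)))
         (total c b a (ℕ+.xy∙z≈zy∙x c b a)) ⟩
  ia * uab * s + ia * uac * s + ib * uba * s + ib * ubc * s + ic * uca * s + ic * ucb * s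
    ≡⟨ solve 10 (λ s ia ib ic uab uac uba ubc uca ucb →
         ia :* uab :* s :+ ia :* uac :* s :+ ib :* uba :* s :+ ib :* ubc :* s :+ ic :* uca :* s :+ ic :* ucb :* s
         := s :* ((ib :* ubc :+ ic :* ucb) :+ (ia :* uac :+ ic :* uca) :+ (ia :* uab :+ ib :* uba)))
       refl s ia ib ic uab uac uba ubc uca ucb ⟩
  s * ((ib * ubc + ic * ucb) + (ia * uac + ic * uca) + (ia * uab + ib * uba))
    ≡⟨ cong (s *_) (cong₂ _+_ (cong₂ _+_ (prefix-pair b c 1≤b 1≤c) (prefix-pair a c 1≤a 1≤c))
                              (prefix-pair a b 1≤a 1≤b)) ⟩
  s * (ib * ic + ia * ic + ia * ib)
    ≡⟨ sym (partial-fractions₃ a b c 1≤a 1≤b 1≤c) ⟩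
  ia * ib * ic ∎
  where
  open ≡-Reasoning
  total : ∀ x y z → x ℕ.+ y ℕ.+ z ≡ a ℕ.+ b ℕ.+ c →
    prefix-inv x y z ≡ inv x * inv (x ℕ.+ y) * inv (a ℕ.+ b ℕ.+ c)
  total x y z eq = cong (λ n → inv x * inv (x ℕ.+ y) * inv n) eq
  s ia ib ic uab uac uba ubc uca ucb : ℚ
  s = inv (a ℕ.+ b ℕ.+ c)
  ia = inv a; ib = inv b; ic = inv c
  uab = inv (a ℕ.+ b); uac = inv (a ℕ.+ c); uba = inv (b ℕ.+ a)
  ubc = inv (b ℕ.+ c); uca = inv (c ℕ.+ a); ucb = inv (c ℕ.+ b)

module Compositions (N : ℕ) where

  Comp : (ℕ → ℕ → ℕ → ℕ → ℚ) → ℚ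
  Comp F = sumTo N λ a → sumTo N λ b → sumTo N λ c → sumTo N λ d →
             when (ℕ._≟ N) (a ℕ.+ b ℕ.+ c ℕ.+ d) (F a b c d)

  Comp-cong : ∀ F G → (∀ a b c d → 1 ≤ a → 1 ≤ b → 1 ≤ c → 1 ≤ d →
                       a ℕ.+ b ℕ.+ c ℕ.+ d ≡ N → F a b c d ≡ G a b c d) → Comp F ≡ Comp G
  Comp-cong F G eq =
    sum-cong N λ a 1≤a _ → sum-cong N λ b 1≤b _ → sum-cong N λ c 1≤c _ → sum-cong N λ d 1≤d _ →
    when-cong (ℕ._≟ N) (eq a b c d 1≤a 1≤b 1≤c 1≤d)

  Comp-ext : ∀ F G → (∀ a b c d → F a b c d ≡ G a b c d) → Comp F ≡ Comp G
  Comp-ext F G eq = Comp-cong F G λ a b c d _ _ _ _ _ → eq a b c d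

  Comp-+ : ∀ F G → Comp (λ a b c d → F a b c d + G a b c d) ≡ Comp F + Comp G
  Comp-+ F G =
    trans (sum-ext N λ a → trans (sum-ext N λ b → trans (sum-ext N λ c →
      trans (sum-ext N λ d → when-+ (ℕ._≟ N) (a ℕ.+ b ℕ.+ c ℕ.+ d) (F a b c d) (G a b c d))
      (sum-+ N _ _)) (sum-+ N _ _)) (sum-+ N _ _)) (sum-+ N _ _)

  Comp-*ˡ : ∀ k F → Comp (λ a b c d → k * F a b c d) ≡ k * Comp F
  Comp-*ˡ k F =
    trans (sum-ext N λ a → trans (sum-ext N λ b → trans (sum-ext N λ c →
      trans (sum-ext N λ d → when-*ˡ (ℕ._≟ N) (a ℕ.+ b ℕ.+ c ℕ.+ d) k (F a b c d))
      (sum-*ˡ N k _)) (sum-*ˡ N k _)) (sum-*ˡ N k _)) (sum-*ˡ N k _)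

  -- Compositions are invariant under permuting the parts; adjacent transpositions
  -- suffice, each being an interchange of two summations.
  Comp-swap₁₂ : ∀ F → Comp F ≡ Comp (λ a b c d → F b a c d)
  Comp-swap₁₂ F = trans
    (fubini N N λ a b → sumTo N λ c → sumTo N λ d → when (ℕ._≟ N) (a ℕ.+ b ℕ.+ c ℕ.+ d) (F a b c d))
    (sum-ext N λ a → sum-ext N λ b → sum-ext N λ c → sum-ext N λ d →
       cong (λ n → when (ℕ._≟ N) (n ℕ.+ c ℕ.+ d) (F b a c d)) (ℕP.+-comm b a))

  Comp-swap₂₃ : ∀ F → Comp F ≡ Comp (λ a b c d → F a c b d)
  Comp-swap₂₃ F = sum-ext N λ a → trans
    (fubini N N λ b c → sumTo N λ d → when (ℕ._≟ N) (a ℕ.+ b ℕ.+ c ℕ.+ d) (F a b c d))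
    (sum-ext N λ b → sum-ext N λ c → sum-ext N λ d →
       cong (λ n → when (ℕ._≟ N) (n ℕ.+ d) (F a c b d)) (ℕ+.xy∙z≈xz∙y a c b))

  Comp-swap₃₄ : ∀ F → Comp F ≡ Comp (λ a b c d → F a b d c)
  Comp-swap₃₄ F = sum-ext N λ a → sum-ext N λ b → trans
    (fubini N N λ c d → when (ℕ._≟ N) (a ℕ.+ b ℕ.+ c ℕ.+ d) (F a b c d))
    (sum-ext N λ c → sum-ext N λ d →
       cong (λ n → when (ℕ._≟ N) n (F a b d c)) (ℕ+.xy∙z≈xz∙y (a ℕ.+ b) d c))

coprime-complement : ∀ {p x y} → p ∣ x ℕ.+ y → Coprime x p → Coprime y p
coprime-complement {p} {x} {y} p∣x+y cop {d} (d∣y , d∣p) =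
  cop (∣m+n∣m⇒∣n (subst (d ∣_) (ℕP.+-comm x y) (∣-trans d∣p p∣x+y)) d∣y , d∣p)

module CoprimeIndicator (p : ℕ) where

  χ : ℕ → ℚ
  χ x = inP p x 1ℚ

  inP-χ : ∀ x q → inP p x q ≡ χ x * q
  inP-χ = when-indicator (λ x → coprime? x p)

  χ-0 : 1 < p → χ 0 ≡ 0ℚ
  χ-0 1<p = when-no (λ x → coprime? x p) 1ℚ λ cop → ℕP.<⇒≢ 1<p (sym (cop (p ∣0 , ∣-refl)))

  weight : ℕ → ℕ → ℕ → ℕ → ℚ
  weight a b c d = χ a * χ b * χ c * χ d

  inP-weight : ∀ a b c d q → inP p a (inP p b (inP p c (inP p d q))) ≡ weight a b c d * q
  inP-weight a b c d q = begin
    inP p a (inP p b (inP p c (inP p d q)))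
      ≡⟨ trans (inP-χ a _) (cong (χ a *_) (trans (inP-χ b _) (cong (χ b *_)
           (trans (inP-χ c _) (cong (χ c *_) (inP-χ d q)))))) ⟩
    χ a * (χ b * (χ c * (χ d * q)))
      ≡⟨ solve 5 (λ a b c d q → a :* (b :* (c :* (d :* q))) := a :* b :* c :* d :* q)
               refl (χ a) (χ b) (χ c) (χ d) q ⟩
    weight a b c d * q ∎
    where open ≡-Reasoning

  χ-complement : ∀ {N s} → p ∣ N → s ≤ N → χ (N ∸ s) ≡ χ s
  χ-complement {N} {s} p∣N s≤N = when-⇔ (λ x → coprime? x p) (N ∸ s) s 1ℚ
    (coprime-complement (subst (p ∣_) (sym (ℕP.m∸n+n≡m s≤N)) p∣N))
    (coprime-complement (subst (p ∣_) (sym (ℕP.m+[n∸m]≡n s≤N)) p∣N))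

fourfold sixfold : ℚ → ℚ
fourfold x = x + x + x + x
sixfold  x = x + x + x + x + x + x

four-times-six : ∀ x y → x * fourfold (sixfold y) ≡ ((+ 24) / 1) * x * y
four-times-six = solve 2 (λ x y →
    x :* ((y :+ y :+ y :+ y :+ y :+ y) :+ (y :+ y :+ y :+ y :+ y :+ y)
          :+ (y :+ y :+ y :+ y :+ y :+ y) :+ (y :+ y :+ y :+ y :+ y :+ y))
    := con ((+ 24) / 1) :* x :* y) refl

module Identity (p N : ℕ) (1<p : 1 < p) (p∣N : p ∣ N) where
  open Compositions N
  open CoprimeIndicator p
  open ≡-Reasoning

  Σ𝒫 : (ℕ → ℕ → ℕ → ℕ → ℚ) → ℚ
  Σ𝒫 W = Comp λ a b c d → weight a b c d * W a b c d

  Σ𝒫-cong : ∀ W V → (∀ a b c d → 1 ≤ a → 1 ≤ b → 1 ≤ c → 1 ≤ d →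
                     a ℕ.+ b ℕ.+ c ℕ.+ d ≡ N → W a b c d ≡ V a b c d) → Σ𝒫 W ≡ Σ𝒫 V
  Σ𝒫-cong W V eq = Comp-cong _ _ λ a b c d 1≤a 1≤b 1≤c 1≤d a+b+c+d≡N →
    cong (weight a b c d *_) (eq a b c d 1≤a 1≤b 1≤c 1≤d a+b+c+d≡N)

  Σ𝒫-+ : ∀ W V → Σ𝒫 (λ a b c d → W a b c d + V a b c d) ≡ Σ𝒫 W + Σ𝒫 V
  Σ𝒫-+ W V = trans
    (Comp-ext _ _ λ a b c d → ℚP.*-distribˡ-+ (weight a b c d) (W a b c d) (V a b c d))
    (Comp-+ _ _)

  Σ𝒫-*ˡ : ∀ k W → Σ𝒫 (λ a b c d → k * W a b c d) ≡ k * Σ𝒫 W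
  Σ𝒫-*ˡ k W = trans
    (Comp-ext _ _ λ a b c d → solve 3 (λ w k x → w :* (k :* x) := k :* (w :* x)) refl
                                       (weight a b c d) k (W a b c d))
    (Comp-*ˡ k _)

  -- The weight is symmetric, so Σ𝒫 inherits the symmetries of Comp.
  Σ𝒫-swap₁₂ : ∀ W → Σ𝒫 W ≡ Σ𝒫 (λ a b c d → W b a c d)
  Σ𝒫-swap₁₂ W = trans (Comp-swap₁₂ _) (Comp-ext _ _ λ a b c d → cong (_* W b a c d)
    (solve 4 (λ a b c d → b :* a :* c :* d := a :* b :* c :* d) refl (χ a) (χ b) (χ c) (χ d)))

  Σ𝒫-swap₂₃ : ∀ W → Σ𝒫 W ≡ Σ𝒫 (λ a b c d → W a c b d)
  Σ𝒫-swap₂₃ W = trans (Comp-swap₂₃ _) (Comp-ext _ _ λ a b c d → cong (_* W a c b d)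
    (solve 4 (λ a b c d → a :* c :* b :* d := a :* b :* c :* d) refl (χ a) (χ b) (χ c) (χ d)))

  Σ𝒫-swap₃₄ : ∀ W → Σ𝒫 W ≡ Σ𝒫 (λ a b c d → W a b d c)
  Σ𝒫-swap₃₄ W = trans (Comp-swap₃₄ _) (Comp-ext _ _ λ a b c d → cong (_* W a b d c)
    (solve 4 (λ a b c d → a :* b :* d :* c := a :* b :* c :* d) refl (χ a) (χ b) (χ c) (χ d)))

  r₁₂₃₄ r₂₃₄ r₁₃₄ r₁₂₄ r₁₂₃ : ℕ → ℕ → ℕ → ℕ → ℚ
  r₁₂₃₄ a b c d = inv a * inv b * inv c * inv d
  r₂₃₄  a b c d = inv b * inv c * inv d
  r₁₃₄  a b c d = inv a * inv c * inv d
  r₁₂₄  a b c d = inv a * inv b * inv d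
  r₁₂₃  a b c d = inv a * inv b * inv c

  -- The left-hand side is Σ𝒫 r₁₂₃₄: sum out d = N - (a + b + c).
  lhs-as-Σ𝒫 : lhsSum p N ≡ Σ𝒫 r₁₂₃₄
  lhs-as-Σ𝒫 = trans
    (sum-ext N λ a → sum-ext N λ b → sum-ext N λ c → sym (sum-last-part N (a ℕ.+ b ℕ.+ c) λ d →
       inP p a (inP p b (inP p c (inP p d (r₁₂₃₄ a b c d))))))
    (Comp-ext _ _ λ a b c d → inP-weight a b c d (r₁₂₃₄ a b c d))

  -- Partial fractions on each composition, 1/(abcd) = (1/N)(1/(bcd) + 1/(acd) + 1/(abd) + 1/(abc)),
  -- and the four resulting sums agree by symmetry.
  four-terms : Σ𝒫 r₁₂₃₄ ≡ inv N * fourfold (Σ𝒫 r₁₂₃)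
  four-terms = begin
    Σ𝒫 r₁₂₃₄
      ≡⟨ Σ𝒫-cong r₁₂₃₄ (λ a b c d → inv N * sum₄ a b c d) (λ a b c d 1≤a 1≤b 1≤c 1≤d a+b+c+d≡N →
           trans (partial-fractions₄ a b c d 1≤a 1≤b 1≤c 1≤d)
                 (cong (λ n → inv n * sum₄ a b c d) a+b+c+d≡N)) ⟩
    Σ𝒫 (λ a b c d → inv N * sum₄ a b c d)
      ≡⟨ Σ𝒫-*ˡ (inv N) sum₄ ⟩
    inv N * Σ𝒫 sum₄
      ≡⟨ cong (inv N *_) (trans (Σ𝒫-+ sum₃ r₁₂₃) (cong (_+ Σ𝒫 r₁₂₃)
           (trans (Σ𝒫-+ sum₂ r₁₂₄) (cong (_+ Σ𝒫 r₁₂₄) (Σ𝒫-+ r₂₃₄ r₁₃₄))))) ⟩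
    inv N * (Σ𝒫 r₂₃₄ + Σ𝒫 r₁₃₄ + Σ𝒫 r₁₂₄ + Σ𝒫 r₁₂₃)
      ≡⟨ cong (λ t → inv N * (t + Σ𝒫 r₁₂₃)) (cong₂ _+_ (cong₂ _+_ (trans r₂₃₄≡r₁₃₄ r₁₃₄≡r₁₂₄) r₁₃₄≡r₁₂₄) refl) ⟩
    inv N * (Σ𝒫 r₁₂₄ + Σ𝒫 r₁₂₄ + Σ𝒫 r₁₂₄ + Σ𝒫 r₁₂₃)
      ≡⟨ cong (λ t → inv N * (t + t + t + Σ𝒫 r₁₂₃)) r₁₂₄≡r₁₂₃ ⟩
    inv N * (Σ𝒫 r₁₂₃ + Σ𝒫 r₁₂₃ + Σ𝒫 r₁₂₃ + Σ𝒫 r₁₂₃) ∎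
    where
    sum₂ sum₃ sum₄ : ℕ → ℕ → ℕ → ℕ → ℚ
    sum₂ a b c d = r₂₃₄ a b c d + r₁₃₄ a b c d
    sum₃ a b c d = sum₂ a b c d + r₁₂₄ a b c d
    sum₄ a b c d = sum₃ a b c d + r₁₂₃ a b c d
    r₂₃₄≡r₁₃₄ : Σ𝒫 r₂₃₄ ≡ Σ𝒫 r₁₃₄
    r₂₃₄≡r₁₃₄ = Σ𝒫-swap₁₂ r₂₃₄
    r₁₃₄≡r₁₂₄ : Σ𝒫 r₁₃₄ ≡ Σ𝒫 r₁₂₄
    r₁₃₄≡r₁₂₄ = Σ𝒫-swap₂₃ r₁₃₄
    r₁₂₄≡r₁₂₃ : Σ𝒫 r₁₂₄ ≡ Σ𝒫 r₁₂₃
    r₁₂₄≡r₁₂₃ = Σ𝒫-swap₃₄ r₁₂₄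

  ρ₁₂₃ ρ₁₃₂ ρ₂₁₃ ρ₂₃₁ ρ₃₁₂ ρ₃₂₁ : ℕ → ℕ → ℕ → ℕ → ℚ
  ρ₁₂₃ a b c d = prefix-inv a b c
  ρ₁₃₂ a b c d = prefix-inv a c b
  ρ₂₁₃ a b c d = prefix-inv b a c
  ρ₂₃₁ a b c d = prefix-inv b c a
  ρ₃₁₂ a b c d = prefix-inv c a b
  ρ₃₂₁ a b c d = prefix-inv c b a

  -- 1/(abc) is the sum of prefix-inv over the six orders, and these sums agree by symmetry.
  six-terms : Σ𝒫 r₁₂₃ ≡ sixfold (Σ𝒫 ρ₁₂₃)
  six-terms = begin
    Σ𝒫 r₁₂₃
      ≡⟨ Σ𝒫-cong r₁₂₃ sum₆ (λ a b c d 1≤a 1≤b 1≤c _ _ → sym (prefix-inv-orders a b c 1≤a 1≤b 1≤c)) ⟩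
    Σ𝒫 sum₆
      ≡⟨ trans (Σ𝒫-+ sum₅ ρ₃₂₁) (cong (_+ Σ𝒫 ρ₃₂₁) (trans (Σ𝒫-+ sum₄ ρ₃₁₂) (cong (_+ Σ𝒫 ρ₃₁₂)
           (trans (Σ𝒫-+ sum₃ ρ₂₃₁) (cong (_+ Σ𝒫 ρ₂₃₁) (trans (Σ𝒫-+ sum₂ ρ₂₁₃) (cong (_+ Σ𝒫 ρ₂₁₃)
           (Σ𝒫-+ ρ₁₂₃ ρ₁₃₂)))))))) ⟩
    Σ𝒫 ρ₁₂₃ + Σ𝒫 ρ₁₃₂ + Σ𝒫 ρ₂₁₃ + Σ𝒫 ρ₂₃₁ + Σ𝒫 ρ₃₁₂ + Σ𝒫 ρ₃₂₁
      ≡⟨ cong₂ _+_ (cong₂ _+_ (cong₂ _+_ (cong₂ _+_ (cong (λ t → Σ𝒫 ρ₁₂₃ + t) ρ₁₃₂≡ρ₁₂₃) ρ₂₁₃≡ρ₁₂₃)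
                                         (trans ρ₂₃₁≡ρ₁₃₂ ρ₁₃₂≡ρ₁₂₃))
                               (trans ρ₃₁₂≡ρ₂₁₃ ρ₂₁₃≡ρ₁₂₃))
                   (trans ρ₃₂₁≡ρ₃₁₂ (trans ρ₃₁₂≡ρ₂₁₃ ρ₂₁₃≡ρ₁₂₃)) ⟩
    Σ𝒫 ρ₁₂₃ + Σ𝒫 ρ₁₂₃ + Σ𝒫 ρ₁₂₃ + Σ𝒫 ρ₁₂₃ + Σ𝒫 ρ₁₂₃ + Σ𝒫 ρ₁₂₃ ∎
    where
    sum₂ sum₃ sum₄ sum₅ sum₆ : ℕ → ℕ → ℕ → ℕ → ℚ
    sum₂ a b c d = ρ₁₂₃ a b c d + ρ₁₃₂ a b c d
    sum₃ a b c d = sum₂ a b c d + ρ₂₁₃ a b c d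
    sum₄ a b c d = sum₃ a b c d + ρ₂₃₁ a b c d
    sum₅ a b c d = sum₄ a b c d + ρ₃₁₂ a b c d
    sum₆ a b c d = sum₅ a b c d + ρ₃₂₁ a b c d
    ρ₁₃₂≡ρ₁₂₃ : Σ𝒫 ρ₁₃₂ ≡ Σ𝒫 ρ₁₂₃
    ρ₁₃₂≡ρ₁₂₃ = sym (Σ𝒫-swap₂₃ ρ₁₂₃)
    ρ₂₁₃≡ρ₁₂₃ : Σ𝒫 ρ₂₁₃ ≡ Σ𝒫 ρ₁₂₃
    ρ₂₁₃≡ρ₁₂₃ = sym (Σ𝒫-swap₁₂ ρ₁₂₃)
    ρ₂₃₁≡ρ₁₃₂ : Σ𝒫 ρ₂₃₁ ≡ Σ𝒫 ρ₁₃₂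
    ρ₂₃₁≡ρ₁₃₂ = sym (Σ𝒫-swap₁₂ ρ₁₃₂)
    ρ₃₁₂≡ρ₂₁₃ : Σ𝒫 ρ₃₁₂ ≡ Σ𝒫 ρ₂₁₃
    ρ₃₁₂≡ρ₂₁₃ = sym (Σ𝒫-swap₂₃ ρ₂₁₃)
    ρ₃₂₁≡ρ₃₁₂ : Σ𝒫 ρ₃₂₁ ≡ Σ𝒫 ρ₃₁₂
    ρ₃₂₁≡ρ₃₁₂ = sym (Σ𝒫-swap₁₂ ρ₃₁₂)

  -- Change of variables u₁ = a, u₂ = a + b, u₃ = a + b + c turns Σ𝒫 ρ₁₂₃ into the
  -- right-hand side.  Both are brought to the nested form Σ_u χ(u) · next (next last) u,
  -- where each `next` sums over the following partial sum; on the composition side the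
  -- inner sums run over the gaps c ≥ 1 instead (next′), which is the same by sum-shift.

  -- the last factor χ(N - u₃)/u₃ (χ(N - u₃) = χ(u₃) since p ∣ N)
  last : ℕ → ℚ
  last v = χ (N ∸ v) * inv v

  next next′ : (ℕ → ℚ) → ℕ → ℚ
  next  f v = inv v * sumTo N (λ u → χ (u ∸ v) * f u)
  next′ f v = inv v * sumTo N (λ c → χ c * f (v ℕ.+ c))

  VanishesBeyondN : (ℕ → ℚ) → Set
  VanishesBeyondN f = ∀ v → N < v → f v ≡ 0ℚ

  -- χ(y - x) = 0 when y ≤ x, since then y - x = 0 is not coprime to p > 1.
  χ-gap : ∀ {x y} → y ≤ x → χ (y ∸ x) ≡ 0ℚ
  χ-gap y≤x = trans (cong χ (ℕP.m≤n⇒m∸n≡0 y≤x)) (χ-0 1<p)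

  gap-guard : ∀ x y q → ifLt x y (χ (y ∸ x) * q) ≡ χ (y ∸ x) * q
  gap-guard x y q = ifLt-redundant x y _ λ y≤x → trans (cong (_* q) (χ-gap y≤x)) (ℚP.*-zeroˡ q)

  last-vanishes : VanishesBeyondN last
  last-vanishes v N<v = trans (cong (_* inv v) (χ-gap (ℕP.<⇒≤ N<v))) (ℚP.*-zeroˡ (inv v))

  next′-vanishes : ∀ f → VanishesBeyondN f → VanishesBeyondN (next′ f)
  next′-vanishes f f-vanishes v N<v = trans
    (cong (inv v *_) (sum-zero N λ c _ _ →
       trans (cong (χ c *_) (f-vanishes (v ℕ.+ c) (ℕP.<-≤-trans N<v (ℕP.m≤m+n v c)))) (ℚP.*-zeroʳ (χ c))))
    (ℚP.*-zeroʳ (inv v))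

  next≡next′ : ∀ f → VanishesBeyondN f → ∀ v → next f v ≡ next′ f v
  next≡next′ f f-vanishes v = cong (inv v *_) (sum-shift v N {χ} {f} (χ-0 1<p) f-vanishes)

  -- Sum out d, drop the guard a + b + c < N (implied by χ(d)), and factor the triple sum.
  composition-side : Σ𝒫 ρ₁₂₃ ≡ sumTo N (λ a → χ a * next′ (next′ last) a)
  composition-side = begin
    Σ𝒫 ρ₁₂₃
      ≡⟨ (sum-ext N λ a → sum-ext N λ b → sum-ext N λ c → sum-last-part N (a ℕ.+ b ℕ.+ c) λ d →
            weight a b c d * prefix-inv a b c) ⟩
    sumTo N (λ a → sumTo N λ b → sumTo N λ c →
      ifLt (a ℕ.+ b ℕ.+ c) N (weight a b c (N ∸ (a ℕ.+ b ℕ.+ c)) * prefix-inv a b c))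
      ≡⟨ (sum-ext N λ a → sum-ext N λ b → sum-ext N λ c → term a b c) ⟩
    sumTo N (λ a → sumTo N λ b → sumTo N λ c →
      χ a * (inv a * (χ b * (inv (a ℕ.+ b) * (χ c * last (a ℕ.+ b ℕ.+ c))))))
      ≡⟨ sum-factor₃ N χ inv (λ _ b → χ b) (λ a b → inv (a ℕ.+ b)) (λ a b c → χ c * last (a ℕ.+ b ℕ.+ c)) ⟩
    sumTo N (λ a → χ a * next′ (next′ last) a) ∎
    where
    term : ∀ a b c → let s = a ℕ.+ b ℕ.+ c in
      ifLt s N (weight a b c (N ∸ s) * prefix-inv a b c) ≡
      χ a * (inv a * (χ b * (inv (a ℕ.+ b) * (χ c * last s))))
    term a b c = begin
      ifLt s N (weight a b c (N ∸ s) * prefix-inv a b c)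
        ≡⟨ cong (ifLt s N) (solve 7 (λ χa χb χc χd ia iab is →
             χa :* χb :* χc :* χd :* (ia :* iab :* is) := χd :* (χa :* χb :* χc :* (ia :* iab :* is)))
             refl (χ a) (χ b) (χ c) (χ (N ∸ s)) (inv a) (inv (a ℕ.+ b)) (inv s)) ⟩
      ifLt s N (χ (N ∸ s) * (χ a * χ b * χ c * prefix-inv a b c))
        ≡⟨ gap-guard s N _ ⟩
      χ (N ∸ s) * (χ a * χ b * χ c * prefix-inv a b c)
        ≡⟨ solve 7 (λ χa χb χc χd ia iab is →
             χd :* (χa :* χb :* χc :* (ia :* iab :* is)) := χa :* (ia :* (χb :* (iab :* (χc :* (χd :* is))))))
             refl (χ a) (χ b) (χ c) (χ (N ∸ s)) (inv a) (inv (a ℕ.+ b)) (inv s) ⟩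
      χ a * (inv a * (χ b * (inv (a ℕ.+ b) * (χ c * last s)))) ∎
      where
      s : ℕ
      s = a ℕ.+ b ℕ.+ c

  -- Drop the guards u₁ < u₂ < u₃ (implied by the gap factors), replace χ(u₃) by χ(N - u₃),
  -- and factor the triple sum.
  rhs-side : rhsSum p N ≡ sumTo N (λ u → χ u * next (next last) u)
  rhs-side = trans
    (sum-ext N λ u₁ → sum-ext N λ u₂ → sum-cong N λ u₃ _ u₃≤N → term u₁ u₂ u₃ u₃≤N)
    (sum-factor₃ N χ inv (λ u₁ u₂ → χ (u₂ ∸ u₁)) (λ _ u₂ → inv u₂) (λ _ u₂ u₃ → χ (u₃ ∸ u₂) * last u₃))
    where
    term : ∀ u₁ u₂ u₃ → u₃ ≤ N →
      ifLt u₁ u₂ (ifLt u₂ u₃ (inP p u₁ (inP p u₃ (inP p (u₂ ∸ u₁) (inP p (u₃ ∸ u₂)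
        (inv u₁ * inv u₂ * inv u₃)))))) ≡
      χ u₁ * (inv u₁ * (χ (u₂ ∸ u₁) * (inv u₂ * (χ (u₃ ∸ u₂) * last u₃))))
    term u₁ u₂ u₃ u₃≤N = begin
      ifLt u₁ u₂ (ifLt u₂ u₃ (inP p u₁ (inP p u₃ (inP p g₁ (inP p g₂ X)))))
        ≡⟨ cong (λ q → ifLt u₁ u₂ (ifLt u₂ u₃ q)) (trans (inP-weight u₁ u₃ g₁ g₂ X)
             (solve 5 (λ χ₁ χ₃ γ₁ γ₂ X → χ₁ :* χ₃ :* γ₁ :* γ₂ :* X := γ₂ :* (γ₁ :* (χ₁ :* χ₃ :* X)))
                    refl (χ u₁) (χ u₃) (χ g₁) (χ g₂) X)) ⟩
      ifLt u₁ u₂ (ifLt u₂ u₃ (χ g₂ * (χ g₁ * (χ u₁ * χ u₃ * X))))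
        ≡⟨ cong (ifLt u₁ u₂) (trans (gap-guard u₂ u₃ _)
             (solve 3 (λ γ₁ γ₂ M → γ₂ :* (γ₁ :* M) := γ₁ :* (γ₂ :* M)) refl (χ g₁) (χ g₂) (χ u₁ * χ u₃ * X))) ⟩
      ifLt u₁ u₂ (χ g₁ * (χ g₂ * (χ u₁ * χ u₃ * X)))
        ≡⟨ gap-guard u₁ u₂ _ ⟩
      χ g₁ * (χ g₂ * (χ u₁ * χ u₃ * X))
        ≡⟨ cong (λ z → χ g₁ * (χ g₂ * (χ u₁ * z * X))) (sym (χ-complement p∣N u₃≤N)) ⟩
      χ g₁ * (χ g₂ * (χ u₁ * χ (N ∸ u₃) * X))
        ≡⟨ solve 7 (λ γ₁ γ₂ χ₁ χ₃ i₁ i₂ i₃ →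
             γ₁ :* (γ₂ :* (χ₁ :* χ₃ :* (i₁ :* i₂ :* i₃))) := χ₁ :* (i₁ :* (γ₁ :* (i₂ :* (γ₂ :* (χ₃ :* i₃))))))
             refl (χ g₁) (χ g₂) (χ u₁) (χ (N ∸ u₃)) (inv u₁) (inv u₂) (inv u₃) ⟩
      χ u₁ * (inv u₁ * (χ g₁ * (inv u₂ * (χ g₂ * last u₃)))) ∎
      where
      g₁ g₂ : ℕ
      g₁ = u₂ ∸ u₁
      g₂ = u₃ ∸ u₂
      X : ℚ
      X = inv u₁ * inv u₂ * inv u₃

  -- The two nested forms agree, as every inner function vanishes beyond N.
  nested-forms-agree : ∀ u → next (next last) u ≡ next′ (next′ last) u
  nested-forms-agree u = trans
    (cong (inv u *_) (sum-ext N λ w → cong (χ (w ∸ u) *_) (next≡next′ last last-vanishes w)))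
    (next≡next′ (next′ last) (next′-vanishes last last-vanishes) u)

  change-of-variables : Σ𝒫 ρ₁₂₃ ≡ rhsSum p N
  change-of-variables = begin
    Σ𝒫 ρ₁₂₃                                       ≡⟨ composition-side ⟩
    sumTo N (λ u → χ u * next′ (next′ last) u)    ≡⟨ sum-ext N (λ u → cong (χ u *_) (sym (nested-forms-agree u))) ⟩
    sumTo N (λ u → χ u * next (next last) u)      ≡⟨ sym rhs-side ⟩
    rhsSum p N                                    ∎

lemma3 : (p r m : ℕ) → Prime p → 4 < p → 0 < r → 0 < m →
    lhsSum p (m ℕ.* p ^ r) ≡ ((+ 24) / 1) * inv (m ℕ.* p ^ r) * rhsSum p (m ℕ.* p ^ r)
lemma3 p (suc r) m _ 4<p _ _ = begin
  lhsSum p N                                ≡⟨ lhs-as-Σ𝒫 ⟩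
  Σ𝒫 r₁₂₃₄                                  ≡⟨ four-terms ⟩
  inv N * fourfold (Σ𝒫 r₁₂₃)                ≡⟨ cong (λ t → inv N * fourfold t) six-terms ⟩
  inv N * fourfold (sixfold (Σ𝒫 ρ₁₂₃))      ≡⟨ cong (λ t → inv N * fourfold (sixfold t)) change-of-variables ⟩
  inv N * fourfold (sixfold (rhsSum p N))   ≡⟨ four-times-six (inv N) (rhsSum p N) ⟩
  ((+ 24) / 1) * inv N * rhsSum p N         ∎
  where
  open ≡-Reasoning
  N : ℕ
  N = m ℕ.* p ^ suc r
  open Identity p N (ℕP.≤-trans (s≤s (s≤s z≤n)) 4<p) (∣n⇒∣m*n m (m∣m*n (p ^ r)))
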